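{- Let $r\ge2$, let $\ell_1,\dots,\ell_r\ge1$ be integers and $\alpha\in W(\ell_1,\dots,\ell_r)$. Suppose Painter plays the strategy $\mathrm{AP}_\alpha(P_{\ell_1},\dots,P_{\ell_r})$ described in the context in the $(P_{\ell_1},\dots,P_{\ell_r})$-avoidance game with some tree size restriction, against an arbitrary Builder. Then throughout the game, except possibly after the last step in which the game ends, the following holds: for each $s\in[r]$ and each $0\le t\le\ell_s-1$, every path on $t$ vertices all of whose vertices have color $s$ on the board is contained in a component with at least $x_{s,t}$ vertices.
   Context: $[r]=\{1,\dots,r\}$; $P_\ell$ is the path on $\ell$ vertices. Game: for a positive integer $k$, the $(P_{\ell_1},\dots,P_{\ell_r})$-avoidance game with tree size restriction $k$ is played by Builder and Painter on a vertex-colored graph (the board), initially empty. In each step Builder adds one new vertex with edges from some previously present vertices to it, so that the board always remains a forest all of whose components have at most $k$ vertices; Painter immediately and irrevocably colors it with a color in $[r]$. The game ends (Painter loses) when for some $s$ the board contains a path on $\ell_s$ vertices all colored $s$. Recursion: $W(\ell_1,\dots,\ell_r)$ is the set of sequences $\alpha=(\alpha_1,\dots,\alpha_d)$, $d=\sum_s(\ell_s-1)$, with entries in $[r]$ having exactly $\ell_s-1$ entries equal to $s$ for each $s$. For $0\le i\le d$ let $\nu_{i,s}:=1+|\{1\le j\le i:\alpha_j=s\}|$. Set $x_{s,0}:=0$ for all $s$, and for $i=0,\dots,d$ in turn let $k_i:=1+\sum_{s\in[r]}\min_{j_1,j_2\ge0,\ j_1+j_2=\nu_{i,s}-1}(x_{s,j_1}+x_{s,j_2})$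 and, if $i<d$, set $x_{s,\nu_{i,s}}:=k_i$ for $s=\alpha_{i+1}$; this defines $x_{s,0},\dots,x_{s,\ell_s-1}$ for each $s$. Fact: for any $\lambda_1,\dots,\lambda_r$ with $1\le\lambda_s\le\ell_s$ and $\lambda_s<\ell_s$ for some $s$, there is a unique $0\le i\le d-1$ such that, with $\sigma=\alpha_{i+1}$, $\nu_{i,\sigma}=\lambda_\sigma$ and $\nu_{i,s}\le\lambda_s$ for $s\ne\sigma$. Strategy $\mathrm{AP}_\alpha(P_{\ell_1},\dots,P_{\ell_r})$: when a new vertex $v$ is presented, for each $s\in[r]$ let $\lambda'_s$ be the number of vertices of a longest path all of whose vertices have color $s$ that would be created (containing $v$) if $v$ were colored $s$, and $\lambda_s:=\min(\lambda'_s,\ell_s)$. If $\lambda_s=\ell_s$ for all $s$, Painter colors $v$ arbitrarily; otherwise she takes the index $i$ from the fact above for these $\lambda_s$ and colors $v$ with $\sigma=\alpha_{i+1}$. -}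

module Defs where

open import Data.Nat using (ℕ; zero; suc; _+_; _∸_; _⊓_; _≤_; _<_)
open import Data.Fin using (Fin) renaming (_≟_ to _≟ᶠ_)
open import Data.Bool using (if_then_else_)
open import Data.List using (List; []; _∷_; _++_; length; filter; map; foldr; upTo; allFin; take)
open import Data.Nat.ListAction using (sum)
open import Data.List.Membership.Propositional using (_∈_)
open import Data.List.Relation.Unary.All using (All)
open import Data.List.Relation.Unary.Unique.Propositional using (Unique)
open import Data.List.Relation.Unary.Linked using (Linked)
open import Data.Product using (Σ; _×_; ∃)
open import Data.Sum using (_⊎_)
open import Relation.Binary.PropositionalEquality using (_≡_; _≢_)
open import Relation.Binary.Construct.Closure.ReflexiveTransitive using (Star)
open import Relation.Nullary using (¬_; does)
import Data.Nat as ℕ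

count : {r : ℕ} → Fin r → List (Fin r) → ℕ
count s xs = length (filter (_≟ᶠ s) xs)

-- ν for the prefix α_1 … α_i  (ν_{i,s} = 1 + #{j ≤ i : α_j = s})
ν : {r : ℕ} → List (Fin r) → Fin r → ℕ
ν pre s = suc (count s pre)

minSplit : (ℕ → ℕ) → ℕ → ℕ
minSplit f m = foldr _⊓_ (f 0 + f m) (map (λ j → f j + f (m ∸ j)) (upTo (suc m)))

kVal : {r : ℕ} → (Fin r → ℕ → ℕ) → (Fin r → ℕ) → ℕ
kVal {r} X cnt = suc (sum (map (λ s → minSplit (X s) (cnt s)) (allFin r)))

-- process α left to right; X holds x_{s,j}, cnt s = ν_{i,s} - 1
xRun : {r : ℕ} → (Fin r → ℕ → ℕ) → (Fin r → ℕ) → List (Fin r) → (Fin r → ℕ → ℕ)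
xRun X cnt [] = X
xRun X cnt (σ ∷ rest) =
  xRun (λ s j → if does (s ≟ᶠ σ) then (if does (j ℕ.≟ suc (cnt σ)) then kVal X cnt else X s j) else X s j)
       (λ s → if does (s ≟ᶠ σ) then suc (cnt s) else cnt s)
       rest

-- x_{s,t} for the sequence α (meaningful for 0 ≤ t ≤ ℓ_s - 1)
x : {r : ℕ} → List (Fin r) → Fin r → ℕ → ℕ
x α = xRun (λ _ _ → 0) (λ _ → 0) α

InW : {r : ℕ} → (Fin r → ℕ) → List (Fin r) → Set
InW {r} ℓ α = (s : Fin r) → count s α ≡ ℓ s ∸ 1

-- Vertices are 0,1,2,… in order of presentation; N j is the list
-- of (earlier) vertices joined to vertex j when it is presented.  The board
-- after m steps consists of vertices 0,…,m-1 and the edges among them.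

Adj : (ℕ → List ℕ) → ℕ → ℕ → ℕ → Set
Adj N m u v = u < m × v < m × (u ∈ N v ⊎ v ∈ N u)

IsPath : (ℕ → List ℕ) → ℕ → List ℕ → Set
IsPath N m p = Unique p × All (_< m) p × Linked (Adj N m) p

IsCycle : (ℕ → List ℕ) → ℕ → List ℕ → Set
IsCycle N m p = 3 ≤ length p × IsPath N m p × Linked (Adj N m) (p ++ take 1 p)

Forest : (ℕ → List ℕ) → ℕ → Set
Forest N m = (p : List ℕ) → ¬ IsCycle N m p

Connected : (ℕ → List ℕ) → ℕ → ℕ → ℕ → Set
Connected N m = Star (Adj N m)

InComponent : (ℕ → List ℕ) → ℕ → ℕ → List ℕ → Set
InComponent N m v L = Unique L × All (λ u → u < m × Connected N m v u) L

ComponentsAtMost : (ℕ → List ℕ) → ℕ → ℕ → Set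
ComponentsAtMost N m k = (v : ℕ) → v < m → (L : List ℕ) → InComponent N m v L → length L ≤ k

ComponentAtLeast : (ℕ → List ℕ) → ℕ → ℕ → ℕ → Set
ComponentAtLeast N m v c = Σ (List ℕ) λ L → InComponent N m v L × c ≤ length L

Mono : {r : ℕ} → (ℕ → Fin r) → Fin r → List ℕ → Set
Mono col s p = All (λ u → col u ≡ s) p

Ended : {r : ℕ} → (Fin r → ℕ) → (ℕ → List ℕ) → (ℕ → Fin r) → ℕ → Set
Ended ℓ N col m = ∃ λ s → Σ (List ℕ) λ p → IsPath N m p × length p ≡ ℓ s × Mono col s p

Cand : {r : ℕ} → (ℕ → List ℕ) → (ℕ → Fin r) → ℕ → Fin r → List ℕ → Set
Cand N col j s p = IsPath N (suc j) p × j ∈ p × All (λ u → u ≡ j ⊎ col u ≡ s) p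

IsLongest : {r : ℕ} → (ℕ → List ℕ) → (ℕ → Fin r) → ℕ → Fin r → ℕ → Set
IsLongest N col j s c =
  (Σ (List ℕ) λ p → Cand N col j s p × length p ≡ c) ×
  ((p : List ℕ) → Cand N col j s p → length p ≤ c)

-- the color of vertex j is the one prescribed by AP_α (any color is allowed
-- when λ_s = ℓ_s for all s).  The index i corresponds to the split
-- α = pre ++ σ ∷ post with i = length pre, σ = α_{i+1}.
APMove : {r : ℕ} → (Fin r → ℕ) → List (Fin r) → (ℕ → List ℕ) → (ℕ → Fin r) → ℕ → Set
APMove {r} ℓ α N col j =
  (λ' : Fin r → ℕ) → ((s : Fin r) → IsLongest N col j s (λ' s)) →
  (∃ λ s → λ' s ⊓ ℓ s < ℓ s) →
  Σ (List (Fin r)) λ pre → Σ (Fin r) λ σ → Σ (List (Fin r)) λ post →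
    α ≡ pre ++ σ ∷ post ×
    ν pre σ ≡ λ' σ ⊓ ℓ σ ×
    ((s : Fin r) → s ≢ σ → ν pre s ≤ λ' s ⊓ ℓ s) ×
    col j ≡ σ

module Submission where

-- Induction on the number m of steps.  A monochromatic colour-s path with t
-- vertices avoiding the newest vertex m already lay on the previous board.
-- Otherwise m is on it, so m received colour s = α_{i+1} for the index i chosen
-- by AP_α.  For each colour s′ the longest path through m that is
-- s′-coloured apart from m has at least ν_{i,s′} vertices; cutting its two sides
-- next to m gives monochromatic arms with j₁ + j₂ = ν_{i,s′} - 1 vertices, and
-- by induction the branches of the forest at these arms have at least
-- x_{s′,j₁} + x_{s′,j₂} vertices.  Branches at distinct neighbours of m are
-- disjoint, so the component of m has at least k_i = x_{s,ν_{i,s}} ≥ x_{s,t}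
-- vertices.

open import Defs
open import Function using (_∘_; id)
open import Data.Empty using (⊥; ⊥-elim)
open import Data.Bool using (true; false; if_then_else_)
open import Data.Product using (_×_; _,_; proj₁; proj₂; ∃)
open import Data.Sum using (_⊎_; inj₁; inj₂; [_,_]′)
open import Data.Maybe using (just)
open import Data.Maybe.Relation.Binary.Connected using (just) renaming (Connected to MaybeRelated)
open import Data.Nat as ℕ using (ℕ; zero; suc; _+_; _∸_; _⊓_; _≤_; _<_; z≤n; s≤s; _≤?_; _<?_)
open import Data.Nat.Properties
open import Data.Nat.ListAction using (sum)
open import Data.Fin using (Fin) renaming (_≟_ to _≟ᶠ_)
open import Data.List
  using (List; []; _∷_; _++_; length; filter; map; foldr; upTo; allFin; take; drop; last; concat)
open import Data.List.Properties using (filter-++; length-++; length-take; length-drop)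
open import Data.List.Membership.Propositional using (_∈_; _∉_)
open import Data.List.Membership.Propositional.Properties
  using (∈-map⁺; ∈-upTo⁺; ∈-upTo⁻; ∈-∃++; ∈-concat⁺′; ∈-filter⁺; ∈-++⁺ˡ; ∈-++⁺ʳ)
open import Data.List.Membership.DecPropositional ℕ._≟_ using (_∈?_)
open import Data.List.Relation.Unary.All as All using (All; []; _∷_)
import Data.List.Relation.Unary.All.Properties as AllP
open import Data.List.Relation.Unary.Any using (here; there)
open import Data.List.Relation.Unary.AllPairs using ([]; _∷_)
open import Data.List.Relation.Unary.Unique.Propositional using (Unique)
import Data.List.Relation.Unary.Unique.Propositional.Properties as UP
open import Data.List.Relation.Unary.Unique.DecPropositional ℕ._≟_ using (unique?)
open import Data.List.Relation.Unary.Linked as Lk using (Linked; []; [-]; _∷_)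
import Data.List.Relation.Unary.Linked.Properties as LkP
open import Relation.Binary.Construct.Closure.ReflexiveTransitive as Star using (ε; _◅_; _◅◅_)
open import Relation.Binary.PropositionalEquality
open import Relation.Nullary using (¬_; Dec; does; yes; no)
open import Relation.Nullary.Decidable using (dec-true; dec-false; _×-dec_; _⊎-dec_)

foldr-⊓-≤ : ∀ b (xs : List ℕ) {y} → y ∈ xs → foldr _⊓_ b xs ≤ y
foldr-⊓-≤ b (x ∷ xs) (here refl) = m⊓n≤m x _
foldr-⊓-≤ b (x ∷ xs) (there y∈) = ≤-trans (m⊓n≤n x _) (foldr-⊓-≤ b xs y∈)

foldr-⊓-greatest : ∀ {B} b (xs : List ℕ) → B ≤ b → All (B ≤_) xs → B ≤ foldr _⊓_ b xs
foldr-⊓-greatest b [] B≤b [] = B≤b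
foldr-⊓-greatest b (x ∷ xs) B≤b (B≤x ∷ B≤xs) = ⊓-glb B≤x (foldr-⊓-greatest b xs B≤b B≤xs)

minSplit-≤ : ∀ f m j → j ≤ m → minSplit f m ≤ f j + f (m ∸ j)
minSplit-≤ f m j j≤m = foldr-⊓-≤ _ _ (∈-map⁺ (λ j → f j + f (m ∸ j)) (∈-upTo⁺ (s≤s j≤m)))

minSplit-greatest : ∀ f m B → (∀ j → j ≤ m → B ≤ f j + f (m ∸ j)) → B ≤ minSplit f m
minSplit-greatest f m B B≤ = foldr-⊓-greatest _ _ (B≤ 0 z≤n)
  (AllP.map⁺ (All.tabulate λ {j} j∈ → B≤ j (≤-pred (∈-upTo⁻ j∈))))

minSplit-mono : ∀ f g m → (∀ j → j ≤ m → f j ≤ g j) → minSplit f m ≤ minSplit g m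
minSplit-mono f g m f≤g = minSplit-greatest g m _ λ j j≤m →
  ≤-trans (minSplit-≤ f m j j≤m) (+-mono-≤ (f≤g j j≤m) (f≤g (m ∸ j) (m∸n≤m m j)))

-- Extending a nondecreasing f on [0, c] by a value g (1 + c) ≥ f c does not
-- decrease the minimum over splits: this is why the k_i never decrease.
minSplit-extend : ∀ f g c → (∀ j → j ≤ c → f j ≡ g j) → (∀ j → suc j ≤ c → f j ≤ f (suc j)) →
  f c ≤ g (suc c) → minSplit f c ≤ minSplit g (suc c)
minSplit-extend f g c f≡g f↑ fc≤ = minSplit-greatest g (suc c) _ bound
  where
  f≤g-shift : ∀ j → j ≤ c → f j ≤ g (suc j)
  f≤g-shift j j≤c with m≤n⇒m<n∨m≡n j≤c
  ... | inj₁ j<c = ≤-trans (f↑ j j<c) (≤-reflexive (f≡g (suc j) j<c))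
  ... | inj₂ refl = fc≤
  bound : ∀ j → j ≤ suc c → minSplit f c ≤ g j + g (suc c ∸ j)
  bound zero _ = ≤-trans (minSplit-≤ f c 0 z≤n) (+-mono-≤ (≤-reflexive (f≡g 0 z≤n)) fc≤)
  bound (suc j) (s≤s j≤c) = ≤-trans (minSplit-≤ f c j j≤c)
    (+-mono-≤ (f≤g-shift j j≤c) (≤-reflexive (f≡g (c ∸ j) (m∸n≤m c j))))

sum-mono : ∀ {A : Set} (f g : A → ℕ) (xs : List A) → (∀ a → f a ≤ g a) → sum (map f xs) ≤ sum (map g xs)
sum-mono f g [] f≤g = z≤n
sum-mono f g (x ∷ xs) f≤g = +-mono-≤ (f≤g x) (sum-mono f g xs f≤g)

module Recursion {r : ℕ} where

  -- The state of the recursion in Defs.xRun: the table of values x_{s,j} found so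
  -- far and the counts ν_{i,s} - 1.  One step for the letter σ records the new
  -- value k_i at position (σ, ν_{i,σ}) and increments the count of σ.
  Table : Set
  Table = Fin r → ℕ → ℕ

  Counts : Set
  Counts = Fin r → ℕ

  stepTable : Table → Counts → Fin r → Table
  stepTable X c σ s j =
    if does (s ≟ᶠ σ) then (if does (j ℕ.≟ suc (c σ)) then kVal X c else X s j) else X s j

  stepCounts : Counts → Fin r → Counts
  stepCounts c σ s = if does (s ≟ᶠ σ) then suc (c s) else c s

  runCounts : Counts → List (Fin r) → Counts
  runCounts c [] = c
  runCounts c (σ ∷ rest) = runCounts (stepCounts c σ) rest

  stepTable-other : ∀ X c σ s j → s ≢ σ → stepTable X c σ s j ≡ X s j
  stepTable-other X c σ s j s≢σ rewrite dec-false (s ≟ᶠ σ) s≢σ = refl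

  stepTable-old : ∀ X c σ s j → j ≢ suc (c σ) → stepTable X c σ s j ≡ X s j
  stepTable-old X c σ s j j≢ rewrite dec-false (j ℕ.≟ suc (c σ)) j≢ with does (s ≟ᶠ σ)
  ... | false = refl
  ... | true = refl

  stepTable-new : ∀ X c σ → stepTable X c σ σ (suc (c σ)) ≡ kVal X c
  stepTable-new X c σ rewrite dec-true (σ ≟ᶠ σ) refl | dec-true (suc (c σ) ℕ.≟ suc (c σ)) refl = refl

  stepCounts-same : ∀ c σ → stepCounts c σ σ ≡ suc (c σ)
  stepCounts-same c σ rewrite dec-true (σ ≟ᶠ σ) refl = refl

  stepCounts-other : ∀ c σ s → s ≢ σ → stepCounts c σ s ≡ c s
  stepCounts-other c σ s s≢σ rewrite dec-false (s ≟ᶠ σ) s≢σ = refl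

  stepCounts-≤ : ∀ c σ s → c s ≤ stepCounts c σ s
  stepCounts-≤ c σ s with does (s ≟ᶠ σ)
  ... | true = n≤1+n (c s)
  ... | false = ≤-refl

  runCounts-count : ∀ c pre s → runCounts c pre s ≡ c s + count s pre
  runCounts-count c [] s = sym (+-identityʳ (c s))
  runCounts-count c (σ ∷ pre) s = trans (runCounts-count (stepCounts c σ) pre s) (step (s ≟ᶠ σ))
    where
    step : Dec (s ≡ σ) → stepCounts c σ s + count s pre ≡ c s + count s (σ ∷ pre)
    step (yes refl) rewrite dec-true (s ≟ᶠ s) refl = sym (+-suc (c s) (count s pre))
    step (no s≢σ) rewrite dec-false (s ≟ᶠ σ) s≢σ | dec-false (σ ≟ᶠ s) (s≢σ ∘ sym) = refl

  -- The invariant of the recursion: each row is nondecreasing up to its current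
  -- count, and each current entry is at most the value k about to be computed.
  Admissible : Table → Counts → Set
  Admissible X c = (∀ s j → suc j ≤ c s → X s j ≤ X s (suc j)) × (∀ s → X s (c s) ≤ kVal X c)

  private
    ≤⇒≢suc : ∀ {j c} → j ≤ c → j ≢ suc c
    ≤⇒≢suc j≤c refl = 1+n≰n j≤c

  kVal-step : ∀ X c σ → Admissible X c → kVal X c ≤ kVal (stepTable X c σ) (stepCounts c σ)
  kVal-step X c σ (X↑ , X≤k) = s≤s (sum-mono _ _ (allFin r) λ s → term s (s ≟ᶠ σ))
    where
    term : ∀ s → Dec (s ≡ σ) → minSplit (X s) (c s) ≤ minSplit (stepTable X c σ s) (stepCounts c σ s)
    term s (no s≢σ) rewrite stepCounts-other c σ s s≢σ =
      minSplit-mono _ _ _ λ j _ → ≤-reflexive (sym (stepTable-other X c σ s j s≢σ))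
    term s (yes refl) rewrite stepCounts-same c s =
      minSplit-extend (X s) (stepTable X c s s) (c s)
        (λ j j≤c → sym (stepTable-old X c s s j (≤⇒≢suc j≤c)))
        (X↑ s)
        (≤-trans (X≤k s) (≤-reflexive (sym (stepTable-new X c s))))

  admissible-step : ∀ X c σ → Admissible X c → Admissible (stepTable X c σ) (stepCounts c σ)
  admissible-step X c σ adm@(X↑ , X≤k) = (λ s j → mono s j (s ≟ᶠ σ)) , (λ s → top s (s ≟ᶠ σ))
    where
    X′ : Table
    X′ = stepTable X c σ
    c′ : Counts
    c′ = stepCounts c σ
    k≤k′ : kVal X c ≤ kVal X′ c′
    k≤k′ = kVal-step X c σ adm
    mono : ∀ s j → Dec (s ≡ σ) → suc j ≤ c′ s → X′ s j ≤ X′ s (suc j)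
    mono s j (no s≢σ) j<c′
      rewrite stepCounts-other c σ s s≢σ | stepTable-other X c σ s j s≢σ | stepTable-other X c σ s (suc j) s≢σ
      = X↑ s j j<c′
    mono s j (yes refl) j<c′ rewrite stepCounts-same c s with m≤n⇒m<n∨m≡n (≤-pred j<c′)
    ... | inj₁ j<c rewrite stepTable-old X c s s j (≤⇒≢suc (<⇒≤ j<c)) | stepTable-old X c s s (suc j) (≤⇒≢suc j<c)
      = X↑ s j j<c
    ... | inj₂ refl rewrite stepTable-old X c s s j (≤⇒≢suc ≤-refl) | stepTable-new X c s = X≤k s
    top : ∀ s → Dec (s ≡ σ) → X′ s (c′ s) ≤ kVal X′ c′
    top s (no s≢σ) rewrite stepCounts-other c σ s s≢σ | stepTable-other X c σ s (c s) s≢σ = ≤-trans (X≤k s) k≤k′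
    top s (yes refl) rewrite stepCounts-same c s | stepTable-new X c s = k≤k′

  admissible-start : Admissible (λ _ _ → 0) (λ _ → 0)
  admissible-start = (λ _ _ ()) , (λ _ → z≤n)

  admissible-run : ∀ pre X c → Admissible X c → Admissible (xRun X c pre) (runCounts c pre)
  admissible-run [] X c adm = adm
  admissible-run (σ ∷ pre) X c adm =
    admissible-run pre (stepTable X c σ) (stepCounts c σ) (admissible-step X c σ adm)

  xRun-frozen : ∀ rest X c s j → j ≤ c s → xRun X c rest s j ≡ X s j
  xRun-frozen [] X c s j j≤c = refl
  xRun-frozen (σ ∷ rest) X c s j j≤c =
    trans (xRun-frozen rest (stepTable X c σ) (stepCounts c σ) s j (≤-trans j≤c (stepCounts-≤ c σ s)))
          (unchanged (s ≟ᶠ σ))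
    where
    unchanged : Dec (s ≡ σ) → stepTable X c σ s j ≡ X s j
    unchanged (no s≢σ) = stepTable-other X c σ s j s≢σ
    unchanged (yes refl) = stepTable-old X c s s j (≤⇒≢suc j≤c)

  xRun-++ : ∀ X c pre rest → xRun X c (pre ++ rest) ≡ xRun (xRun X c pre) (runCounts c pre) rest
  xRun-++ X c [] rest = refl
  xRun-++ X c (σ ∷ pre) rest = xRun-++ (stepTable X c σ) (stepCounts c σ) pre rest

  table : List (Fin r) → Table
  table pre = xRun (λ _ _ → 0) (λ _ → 0) pre

  counts : List (Fin r) → Counts
  counts pre = runCounts (λ _ → 0) pre

  counts-count : ∀ pre s → counts pre s ≡ count s pre
  counts-count pre s = runCounts-count (λ _ → 0) pre s

  count-++ : ∀ s (pre post : List (Fin r)) → count s (pre ++ post) ≡ count s pre + count s post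
  count-++ s pre post = trans (cong length (filter-++ (_≟ᶠ s) pre post)) (length-++ (filter (_≟ᶠ s) pre))

  x-zero : ∀ α s → x α s 0 ≡ 0
  x-zero α s = xRun-frozen α (λ _ _ → 0) (λ _ → 0) s 0 z≤n

  x-mono : ∀ α s {i j} → i ≤ j → j ≤ count s α → x α s i ≤ x α s j
  x-mono α s {i} {j} i≤j j≤c = go j i≤j j≤c
    where
    step : ∀ j → suc j ≤ count s α → x α s j ≤ x α s (suc j)
    step j j<c = proj₁ (admissible-run α (λ _ _ → 0) (λ _ → 0) admissible-start) s j
      (subst (suc j ≤_) (sym (counts-count α s)) j<c)
    go : ∀ j → i ≤ j → j ≤ count s α → x α s i ≤ x α s j
    go j i≤j j≤c with m≤n⇒m<n∨m≡n i≤j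
    ... | inj₂ refl = ≤-refl
    go (suc j) i≤j j≤c | inj₁ (s≤s i≤j′) = ≤-trans (go j i≤j′ (≤-trans (n≤1+n j) j≤c)) (step j j≤c)

  x-frozen : ∀ {α : List (Fin r)} pre σ post → α ≡ pre ++ σ ∷ post →
    ∀ s {j} → j ≤ count s pre → x α s j ≡ table pre s j
  x-frozen pre σ post refl s {j} j≤c = begin
    x (pre ++ σ ∷ post) s j                       ≡⟨ cong (λ X → X s j) (xRun-++ _ _ pre (σ ∷ post)) ⟩
    xRun (table pre) (counts pre) (σ ∷ post) s j  ≡⟨ xRun-frozen (σ ∷ post) _ _ s j
                                                       (subst (j ≤_) (sym (counts-count pre s)) j≤c) ⟩
    table pre s j                                 ∎
    where open ≡-Reasoning

  x-new : ∀ {α : List (Fin r)} pre σ post → α ≡ pre ++ σ ∷ post →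
    x α σ (ν pre σ) ≡ kVal (table pre) (counts pre)
  x-new pre σ post refl = begin
    x (pre ++ σ ∷ post) σ (ν pre σ)  ≡⟨ cong (λ X → X σ (ν pre σ)) (xRun-++ _ _ pre (σ ∷ post)) ⟩
    xRun X′ c′ post σ (ν pre σ)      ≡⟨ xRun-frozen post X′ c′ σ _ (≤-reflexive ν≡c′) ⟩
    X′ σ (ν pre σ)                   ≡⟨ cong (X′ σ) ν≡c ⟩
    X′ σ (suc (counts pre σ))        ≡⟨ stepTable-new (table pre) (counts pre) σ ⟩
    kVal (table pre) (counts pre)    ∎
    where
    open ≡-Reasoning
    X′ : Table
    X′ = stepTable (table pre) (counts pre) σ
    c′ : Counts
    c′ = stepCounts (counts pre) σ
    ν≡c : ν pre σ ≡ suc (counts pre σ)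
    ν≡c = cong suc (sym (counts-count pre σ))
    ν≡c′ : ν pre σ ≡ c′ σ
    ν≡c′ = trans ν≡c (sym (stepCounts-same (counts pre) σ))

  ν-≤-count : ∀ {α : List (Fin r)} pre σ post → α ≡ pre ++ σ ∷ post → ν pre σ ≤ count σ α
  ν-≤-count pre σ post refl rewrite count-++ σ pre (σ ∷ post) | dec-true (σ ≟ᶠ σ) refl =
    ≤-trans (s≤s (m≤m+n (count σ pre) _)) (≤-reflexive (sym (+-suc (count σ pre) _)))

  minSplit-table : ∀ {α : List (Fin r)} pre σ post → α ≡ pre ++ σ ∷ post → ∀ s {j} → j ≤ count s pre →
    minSplit (table pre s) (counts pre s) ≤ x α s j + x α s (count s pre ∸ j)
  minSplit-table pre σ post α≡ s {j} j≤c rewrite counts-count pre s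
    | x-frozen pre σ post α≡ s j≤c | x-frozen pre σ post α≡ s (m∸n≤m (count s pre) j) =
    minSplit-≤ (table pre s) (count s pre) j j≤c

module ListFacts {A : Set} where

  unique-++⁻ : ∀ (xs : List A) {ys} → Unique (xs ++ ys) →
    Unique xs × Unique ys × (∀ {x y} → x ∈ xs → y ∈ ys → x ≢ y)
  unique-++⁻ [] ys! = [] , ys! , λ ()
  unique-++⁻ (x ∷ xs) (x∉ ∷ xsys!) with unique-++⁻ xs xsys!
  ... | xs! , ys! , disj = AllP.++⁻ˡ xs x∉ ∷ xs! , ys! , cross
    where
    cross : ∀ {z y} → z ∈ x ∷ xs → y ∈ _ → z ≢ y
    cross (here refl) y∈ = All.lookup (AllP.++⁻ʳ xs x∉) y∈
    cross (there z∈) y∈ = disj z∈ y∈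

  module _ {R : A → A → Set} where

    linked-++⁻ : ∀ (xs : List A) {ys} → Linked R (xs ++ ys) → Linked R xs × Linked R ys
    linked-++⁻ [] l = [] , l
    linked-++⁻ (x ∷ []) l = [-] , Lk.tail l
    linked-++⁻ (x ∷ y ∷ xs) (r ∷ l) with linked-++⁻ (y ∷ xs) l
    ... | lxs , lys = r ∷ lxs , lys

    linked-take : ∀ j {xs} → Linked R xs → Linked R (take j xs)
    linked-take zero l = []
    linked-take (suc j) [] = []
    linked-take (suc zero) [-] = [-]
    linked-take (suc (suc j)) [-] = [-]
    linked-take (suc zero) (r ∷ l) = [-]
    linked-take (suc (suc j)) (r ∷ l) = r ∷ linked-take (suc j) l

    linked-drop-++ : ∀ k xs {ys} → Linked R (xs ++ ys) → Linked R (drop k xs ++ ys)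
    linked-drop-++ zero xs l = l
    linked-drop-++ (suc k) [] l = l
    linked-drop-++ (suc k) (x ∷ xs) l = linked-drop-++ k xs (Lk.tail l)

    linked-into : ∀ P {y ys} → Linked R (P ++ y ∷ ys) → P ≢ [] → ∃ λ u → u ∈ P × R u y
    linked-into [] l P≢[] = ⊥-elim (P≢[] refl)
    linked-into (x ∷ []) (r ∷ _) _ = x , here refl , r
    linked-into (x ∷ z ∷ P) (_ ∷ l) _ with linked-into (z ∷ P) l (λ ())
    ... | u , u∈ , r = u , there u∈ , r

  last-++ : ∀ xs {y : A} ys → last (xs ++ y ∷ ys) ≡ last (y ∷ ys)
  last-++ [] ys = refl
  last-++ (x ∷ []) ys = refl
  last-++ (x ∷ x′ ∷ xs) ys = last-++ (x′ ∷ xs) ys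

all-<-pred : ∀ {n xs} → All (_< suc n) xs → All (_≢ n) xs → All (_< n) xs
all-<-pred xs<n+1 xs≢n = All.zipWith (λ (z<n+1 , z≢n) → ≤∧≢⇒< (≤-pred z<n+1) z≢n) (xs<n+1 , xs≢n)

∉⇒all≢ : ∀ {n : ℕ} xs → n ∉ xs → All (_≢ n) xs
∉⇒all≢ xs n∉ = All.map (_∘ sym) (AllP.¬Any⇒All¬ xs n∉)

unique-<-length : ∀ n xs → Unique xs → All (_< n) xs → length xs ≤ n
unique-<-length zero [] _ _ = z≤n
unique-<-length zero (x ∷ xs) _ (() ∷ _)
unique-<-length (suc n) xs xs! xs<n with n ∈? xs
... | no n∉ = m≤n⇒m≤1+n (unique-<-length n xs xs! (all-<-pred xs<n (∉⇒all≢ xs n∉)))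
... | yes n∈ with ∈-∃++ n∈
... | as , bs , refl with ListFacts.unique-++⁻ as xs!
... | as! , (n∉bs ∷ bs!) , disj = begin
  length (as ++ n ∷ bs)        ≡⟨ length-++ as ⟩
  length as + suc (length bs)  ≡⟨ +-suc (length as) (length bs) ⟩
  suc (length as + length bs)  ≡⟨ cong suc (length-++ as) ⟨
  suc (length (as ++ bs))      ≤⟨ s≤s (unique-<-length n (as ++ bs) rest! rest<n) ⟩
  suc n                        ∎
  where
  open ≤-Reasoning
  rest! : Unique (as ++ bs)
  rest! = UP.++⁺ as! bs! λ (a∈ , b∈) → disj a∈ (there b∈) refl
  rest≢n : All (_≢ n) (as ++ bs)
  rest≢n = AllP.++⁺ (All.tabulate λ a∈ → disj a∈ (here refl)) (All.map (_∘ sym) n∉bs)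
  rest<n : All (_< n) (as ++ bs)
  rest<n = all-<-pred (AllP.++⁺ (AllP.++⁻ˡ as xs<n) (All.tail (AllP.++⁻ʳ as xs<n))) rest≢n

lists : ℕ → ℕ → List (List ℕ)
lists zero m = [] ∷ []
lists (suc L) m = [] ∷ concat (map (λ v → map (v ∷_) (lists L m)) (upTo m))

lists-complete : ∀ L m xs → All (_< m) xs → length xs ≤ L → xs ∈ lists L m
lists-complete zero m [] _ _ = here refl
lists-complete (suc L) m [] _ _ = here refl
lists-complete (suc L) m (v ∷ xs) (v<m ∷ xs<m) (s≤s len) = there (∈-concat⁺′
  (∈-map⁺ (v ∷_) (lists-complete L m xs xs<m len))
  (∈-map⁺ (λ v → map (v ∷_) (lists L m)) (∈-upTo⁺ v<m)))

longest-satisfying : (P : List ℕ → Set) (ys : List (List ℕ)) → All P ys → ∀ {y₀} → P y₀ →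
  ∃ λ y → P y × All (λ z → length z ≤ length y) (y₀ ∷ ys)
longest-satisfying P [] [] {y₀} py₀ = y₀ , py₀ , ≤-refl ∷ []
longest-satisfying P (y ∷ ys) (py ∷ pys) py₀ with longest-satisfying P ys pys py₀
... | b , pb , y₀≤b ∷ ys≤b with length y ≤? length b
... | yes y≤b = b , pb , y₀≤b ∷ y≤b ∷ ys≤b
... | no y≰b = y , py , ≤-trans y₀≤b b≤y ∷ ≤-refl ∷ All.map (λ z≤b → ≤-trans z≤b b≤y) ys≤b
  where
  b≤y = <⇒≤ (≰⇒> y≰b)

split-≤ : ∀ c a b → c ≤ a + b → ∃ λ i → i ≤ c × i ≤ a × c ∸ i ≤ b
split-≤ c a b c≤a+b with ≤-total c a
... | inj₁ c≤a = c , ≤-refl , c≤a , subst (_≤ b) (sym (n∸n≡0 c)) z≤n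
... | inj₂ a≤c = a , a≤c , ≤-refl , m≤n+o⇒m∸n≤o c a c≤a+b

module Board (N : ℕ → List ℕ) where
  open ListFacts

  adj-sym : ∀ {m u v} → Adj N m u v → Adj N m v u
  adj-sym (u<m , v<m , inj₁ u∈) = v<m , u<m , inj₂ u∈
  adj-sym (u<m , v<m , inj₂ v∈) = v<m , u<m , inj₁ v∈

  adj-lift : ∀ {m m′} → m ≤ m′ → ∀ {u v} → Adj N m u v → Adj N m′ u v
  adj-lift m≤m′ (u<m , v<m , e) = <-≤-trans u<m m≤m′ , <-≤-trans v<m m≤m′ , e

  connected-lift : ∀ {m m′} → m ≤ m′ → ∀ {u v} → Connected N m u v → Connected N m′ u v
  connected-lift m≤m′ = Star.map (adj-lift m≤m′)

  linked-lift : ∀ {m m′} → m ≤ m′ → ∀ {p} → Linked (Adj N m) p → Linked (Adj N m′) p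
  linked-lift m≤m′ = Lk.map (adj-lift m≤m′)

  path-lift : ∀ {m m′} → m ≤ m′ → ∀ {p} → IsPath N m p → IsPath N m′ p
  path-lift m≤m′ (p! , p<m , lp) = p! , All.map (λ u<m → <-≤-trans u<m m≤m′) p<m , linked-lift m≤m′ lp

  linked-restrict : ∀ {m p} → Linked (Adj N (suc m)) p → All (_< m) p → Linked (Adj N m) p
  linked-restrict [] _ = []
  linked-restrict [-] _ = [-]
  linked-restrict ((_ , _ , e) ∷ l) (u<m ∷ p<m@(v<m ∷ _)) = (u<m , v<m , e) ∷ linked-restrict l p<m

  path-restrict : ∀ {m p} → IsPath N (suc m) p → m ∉ p → IsPath N m p
  path-restrict {m} {p} (p! , p<m+1 , lp) m∉p = p! , p<m , linked-restrict lp p<m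
    where
    p<m : All (_< m) p
    p<m = all-<-pred p<m+1 (∉⇒all≢ p m∉p)

  component-lift : ∀ {m m′} → m ≤ m′ → ∀ {v c} → ComponentAtLeast N m v c → ComponentAtLeast N m′ v c
  component-lift m≤m′ (L , (L! , inL) , size) =
    L , (L! , All.map (λ (z<m , v~z) → <-≤-trans z<m m≤m′ , connected-lift m≤m′ v~z) inL) , size

  connected-sym : ∀ {m u v} → Connected N m u v → Connected N m v u
  connected-sym = Star.reverse adj-sym

  connected-below : ∀ {m u z} → u < m → Connected N m u z → z < m
  connected-below u<m ε = u<m
  connected-below u<m ((_ , v<m , _) ◅ walk) = connected-below v<m walk

  linked-connected : ∀ {m p u w} → Linked (Adj N m) p → u ∈ p → w ∈ p → Connected N m u w
  linked-connected {m} {p = x ∷ _} l u∈ w∈ = connected-sym (from-head l u∈) ◅◅ from-head l w∈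
    where
    from-head : ∀ {x xs u} → Linked (Adj N m) (x ∷ xs) → u ∈ x ∷ xs → Connected N m x u
    from-head _ (here refl) = ε
    from-head (r ∷ l) (there u∈) = r ◅ from-head l u∈

  walk⇒path : ∀ {m u w} → u < m → Connected N m u w →
    ∃ λ L → IsPath N m (u ∷ L) × last (u ∷ L) ≡ just w
  walk⇒path u<m ε = [] , ([] ∷ [] , u<m ∷ [] , [-]) , refl
  walk⇒path {u = u} u<m (a@(_ , v<m , _) ◅ walk) with walk⇒path v<m walk
  ... | L , (vL! , vL<m , lvL) , end with u ∈? (_ ∷ L)
  ... | no u∉ = (_ ∷ L) , (AllP.¬Any⇒All¬ _ u∉ ∷ vL! , u<m ∷ vL<m , a ∷ lvL) , end
  ... | yes u∈ with ∈-∃++ u∈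
  ... | xs , ys , vL≡ = ys , (uys! , uys<m , luys) , trans (sym (last-++ xs ys)) (trans (cong last (sym vL≡)) end)
    where
    uys! : Unique (u ∷ ys)
    uys! = proj₁ (proj₂ (unique-++⁻ xs (subst Unique vL≡ vL!)))
    uys<m : All (_< _) (u ∷ ys)
    uys<m = AllP.++⁻ʳ xs (subst (All _) vL≡ vL<m)
    luys : Linked (Adj N _) (u ∷ ys)
    luys = proj₂ (linked-++⁻ xs (subst (Linked _) vL≡ lvL))

  -- Removing the newest vertex m from board m + 1 leaves one branch per neighbour
  -- u of m: Branch m u z says that z lies in the branch at u.
  Branch : ℕ → ℕ → ℕ → Set
  Branch m u z = u < m × Adj N (suc m) m u × Connected N m u z

  -- In a forest, the branches at distinct neighbours of m are disjoint: otherwise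
  -- a path between the two neighbours would close a cycle through m.
  branch-unique : ∀ {m u₁ u₂ z} → Forest N (suc m) → Branch m u₁ z → Branch m u₂ z → u₁ ≡ u₂
  branch-unique {m} {u₁} {u₂} forest (u₁<m , m~u₁ , u₁~z) (u₂<m , m~u₂ , u₂~z) with u₁ ℕ.≟ u₂
  ... | yes u₁≡u₂ = u₁≡u₂
  ... | no u₁≢u₂ with walk⇒path u₁<m (u₁~z ◅◅ connected-sym u₂~z)
  ... | [] , _ , refl = ⊥-elim (u₁≢u₂ refl)
  ... | L@(_ ∷ L′) , (P! , P<m , lP) , end = ⊥-elim (forest C (three , (C! , C<m , lC) , lCC))
    where
    P : List ℕ
    P = u₁ ∷ L
    C : List ℕ
    C = P ++ m ∷ []
    three : 3 ≤ length C
    three = s≤s (s≤s (subst (1 ≤_) (sym (length-++ L′)) (m≤n+m 1 (length L′))))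
    C! : Unique C
    C! = UP.++⁺ P! ([] ∷ []) λ { (m∈P , here refl) → <-irrefl refl (All.lookup P<m m∈P) }
    C<m : All (_< suc m) C
    C<m = AllP.++⁺ (All.map (λ u<m → <-≤-trans u<m (n≤1+n m)) P<m) (≤-refl ∷ [])
    lC : Linked (Adj N (suc m)) C
    lC = LkP.++⁺ (linked-lift (n≤1+n m) lP)
      (subst (λ e → MaybeRelated (Adj N (suc m)) e (just m)) (sym end) (just (adj-sym m~u₂))) [-]
    lCC : Linked (Adj N (suc m)) (C ++ take 1 C)
    lCC = LkP.++⁺ lC
      (subst (λ e → MaybeRelated (Adj N (suc m)) e (just u₁)) (sym (last-++ P [])) (just m~u₁)) [-]

  adj? : ∀ m u v → Dec (Adj N m u v)
  adj? m u v = (u <? m) ×-dec (v <? m) ×-dec ((u ∈? N v) ⊎-dec (v ∈? N u))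

  path? : ∀ m p → Dec (IsPath N m p)
  path? m p = unique? p ×-dec All.all? (_<? m) p ×-dec Lk.linked? (adj? m) p

  module _ {r : ℕ} (col : ℕ → Fin r) where

    cand? : ∀ j s p → Dec (Cand N col j s p)
    cand? j s p = path? (suc j) p ×-dec (j ∈? p) ×-dec All.all? (λ u → (u ℕ.≟ j) ⊎-dec (col u ≟ᶠ s)) p

    -- Every candidate path through j is among these (a path has distinct vertices).
    candidates : ℕ → Fin r → List (List ℕ)
    candidates j s = filter (cand? j s) (lists (suc j) (suc j))

    candidates-complete : ∀ {j s p} → Cand N col j s p → p ∈ candidates j s
    candidates-complete {j} {s} {p} cand-p@((p! , p<j , _) , _) =
      ∈-filter⁺ (cand? j s) (lists-complete (suc j) (suc j) p p<j (unique-<-length (suc j) p p! p<j)) cand-p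

    -- λ′_s is well defined: a longest candidate path exists, since there are
    -- finitely many candidates and the one-vertex path [j] is one of them.
    longest-candidate : ∀ j s → ∃ λ c → IsLongest N col j s c
    longest-candidate j s
      with longest-satisfying (Cand N col j s) (candidates j s)
             (AllP.all-filter (cand? j s) (lists (suc j) (suc j))) {j ∷ []} (([] ∷ [] , ≤-refl ∷ [] , [-]) , here refl , inj₁ refl ∷ [])
    ... | q , cand-q , maximal =
      length q , (q , cand-q , refl) , λ p cand-p → All.lookup maximal (there (candidates-complete cand-p))

module Game {r : ℕ} (ℓ : Fin r → ℕ) (α : List (Fin r)) (N : ℕ → List ℕ) (col : ℕ → Fin r) where
  open Board N
  open Recursion
  open ListFacts

  Bounded : ℕ → Set
  Bounded m = ∀ s t → t ≤ ℓ s ∸ 1 → (p : List ℕ) → IsPath N m p → length p ≡ t → Mono col s p →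
              ∀ v → v ∈ p → ComponentAtLeast N m v (x α s t)

  Branches : ℕ → (ℕ → Set) → List ℕ → Set
  Branches m S L = Unique L × All (λ z → ∃ λ u → S u × Branch m u z) L

  branches-weaken : ∀ {m S S′ L} → (∀ {u} → S u → S′ u) → Branches m S L → Branches m S′ L
  branches-weaken S⇒S′ (L! , inL) = L! , All.map (λ (u , Su , br) → u , S⇒S′ Su , br) inL

  branches-++ : ∀ {m S₁ S₂ L₁ L₂} → Forest N (suc m) → (∀ {u} → S₁ u → S₂ u → ⊥) →
    Branches m S₁ L₁ → Branches m S₂ L₂ → Branches m (λ u → S₁ u ⊎ S₂ u) (L₁ ++ L₂)
  branches-++ {m} {S₁} {S₂} forest S₁#S₂ (L₁! , inL₁) (L₂! , inL₂) =
    UP.++⁺ L₁! L₂! (λ (z∈₁ , z∈₂) → disjoint (All.lookup inL₁ z∈₁) (All.lookup inL₂ z∈₂)) ,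
    AllP.++⁺ (All.map (λ (u , Su , br) → u , inj₁ Su , br) inL₁)
             (All.map (λ (u , Su , br) → u , inj₂ Su , br) inL₂)
    where
    disjoint : ∀ {z} → (∃ λ u → S₁ u × Branch m u z) → (∃ λ u → S₂ u × Branch m u z) → ⊥
    disjoint (u₁ , S₁u₁ , br₁) (u₂ , S₂u₂ , br₂) with branch-unique forest br₁ br₂
    ... | refl = S₁#S₂ S₁u₁ S₂u₂

  branches-component : ∀ {m S L v} → Branches m S L → Connected N (suc m) v m → InComponent N (suc m) v (m ∷ L)
  branches-component {m} (L! , inL) v~m =
    All.map (λ (_ , _ , u<m , _ , u~z) z≡m → <-irrefl (sym z≡m) (connected-below u<m u~z)) inL ∷ L! ,
    (≤-refl , v~m) ∷ All.map (λ (_ , _ , u<m , m~u , u~z) →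
      <-≤-trans (connected-below u<m u~z) (n≤1+n m) , v~m ◅◅ (m~u ◅ connected-lift (n≤1+n m) u~z)) inL

  -- An arm: a monochromatic path of board m that is empty or touches the new
  -- vertex m.  By the assertion for board m, the branches at its vertices
  -- contain at least x_{s,|P|} vertices.
  Touches : ℕ → List ℕ → Set
  Touches m P = P ≡ [] ⊎ ∃ λ u → u ∈ P × Adj N (suc m) m u

  arm-branches : ∀ {m s S j} → Bounded m → (P : List ℕ) → IsPath N m P → Mono col s P → All S P →
    Touches m P → length P ≡ j → j ≤ ℓ s ∸ 1 → ∃ λ L → Branches m S L × x α s j ≤ length L
  arm-branches {s = s} _ _ _ _ _ (inj₁ refl) refl _ = [] , ([] , []) , ≤-reflexive (x-zero α s)
  arm-branches {s = s} bounded P path@(_ , P<m , _) mono SP (inj₂ (u , u∈ , m~u)) len j≤ℓ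
    with bounded s _ j≤ℓ P path len mono u u∈
  ... | L , (L! , inL) , size =
    L , (L! , All.map (λ (_ , u~z) → u , All.lookup SP u∈ , All.lookup P<m u∈ , m~u , u~z) inL) , size

  touches-take : ∀ {m} j {b} → Linked (Adj N (suc m)) (m ∷ b) → Touches m (take j b)
  touches-take zero _ = inj₁ refl
  touches-take (suc j) {[]} _ = inj₁ refl
  touches-take (suc j) {u ∷ b} l = inj₂ (u , here refl , Lk.head l)

  touches-before : ∀ {m} P {ys} → Linked (Adj N (suc m)) (P ++ m ∷ ys) → Touches m P
  touches-before [] _ = inj₁ refl
  touches-before P@(_ ∷ _) l with linked-into P l (λ ())
  ... | u , u∈ , u~m = inj₂ (u , u∈ , adj-sym u~m)

  -- A candidate path a ++ m ∷ b of colour s through the new vertex m: its two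
  -- sides a and b consist of colour-s vertices of board m, and cutting them down
  -- next to m gives arms of any length up to their sizes.
  module Arms {m s} (bounded : Bounded m) (a b : List ℕ) (q! : Unique (a ++ m ∷ b))
    (q<m+1 : All (_< suc m) (a ++ m ∷ b)) (lq : Linked (Adj N (suc m)) (a ++ m ∷ b))
    (colours : All (λ u → u ≡ m ⊎ col u ≡ s) (a ++ m ∷ b)) where

    a! : Unique a
    a! = proj₁ (unique-++⁻ a q!)

    mb! : Unique (m ∷ b)
    mb! = proj₁ (proj₂ (unique-++⁻ a q!))

    m∉b : All (m ≢_) b
    m∉b with mb!
    ... | m∉b ∷ _ = m∉b

    b! : Unique b
    b! with mb!
    ... | _ ∷ b! = b!

    a#mb : ∀ {y z} → y ∈ a → z ∈ m ∷ b → y ≢ z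
    a#mb = proj₂ (proj₂ (unique-++⁻ a q!))

    side : ∀ {z} → z ∈ a ⊎ z ∈ b → z < m × col z ≡ s
    side {z} z∈ = ≤∧≢⇒< (≤-pred (All.lookup q<m+1 z∈q)) z≢m , colour (All.lookup colours z∈q)
      where
      z∈q : z ∈ a ++ m ∷ b
      z∈q = [ ∈-++⁺ˡ , (λ z∈b → ∈-++⁺ʳ a (there z∈b)) ]′ z∈
      z≢m : z ≢ m
      z≢m = [ (λ z∈a → a#mb z∈a (here refl)) , (λ z∈b z≡m → All.lookup m∉b z∈b (sym z≡m)) ]′ z∈
      colour : z ≡ m ⊎ col z ≡ s → col z ≡ s
      colour = [ (λ z≡m → ⊥-elim (z≢m z≡m)) , id ]′

    arm-path : ∀ {P} → (∀ {z} → z ∈ P → z ∈ a ⊎ z ∈ b) → Unique P → Linked (Adj N (suc m)) P →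
      IsPath N m P × Mono col s P
    arm-path {P} on-side P! lP =
      (P! , P<m , linked-restrict lP P<m) , All.tabulate (λ z∈ → proj₂ (side (on-side z∈)))
      where
      P<m : All (_< m) P
      P<m = All.tabulate (λ z∈ → proj₁ (side (on-side z∈)))

    right-arm : ∀ j → j ≤ length b → j ≤ ℓ s ∸ 1 → ∃ λ L → Branches m (_∈ b) L × x α s j ≤ length L
    right-arm j j≤b j≤ℓ = arm-branches bounded P (proj₁ P-path) (proj₂ P-path) P⊆b (touches-take j lmb)
      (trans (length-take j b) (m≤n⇒m⊓n≡m j≤b)) j≤ℓ
      where
      P : List ℕ
      P = take j b
      lmb : Linked (Adj N (suc m)) (m ∷ b)
      lmb = proj₂ (linked-++⁻ a lq)
      P⊆b : All (_∈ b) P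
      P⊆b = AllP.take⁺ j (All.tabulate id)
      P-path : IsPath N m P × Mono col s P
      P-path = arm-path (λ z∈ → inj₂ (All.lookup P⊆b z∈)) (UP.take⁺ j b!) (linked-take j (Lk.tail lmb))

    left-arm : ∀ j → j ≤ length a → j ≤ ℓ s ∸ 1 → ∃ λ L → Branches m (_∈ a) L × x α s j ≤ length L
    left-arm j j≤a j≤ℓ = arm-branches bounded P (proj₁ P-path) (proj₂ P-path) P⊆a (touches-before P lP)
      (trans (length-drop k a) (m∸[m∸n]≡n j≤a)) j≤ℓ
      where
      k : ℕ
      k = length a ∸ j
      P : List ℕ
      P = drop k a
      lP : Linked (Adj N (suc m)) (P ++ m ∷ b)
      lP = linked-drop-++ k a lq
      P⊆a : All (_∈ a) P
      P⊆a = AllP.drop⁺ k (All.tabulate id)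
      P-path : IsPath N m P × Mono col s P
      P-path = arm-path (λ z∈ → inj₁ (All.lookup P⊆a z∈)) (UP.drop⁺ k a!) (proj₁ (linked-++⁻ P lP))

    both-arms : Forest N (suc m) → ∀ c → c ≤ ℓ s ∸ 1 → c ≤ length a + length b →
      ∃ λ j → j ≤ c × ∃ λ L → Branches m (λ u → col u ≡ s) L × x α s j + x α s (c ∸ j) ≤ length L
    both-arms forest c c≤ℓ c≤a+b with split-≤ c (length a) (length b) c≤a+b
    ... | i , i≤c , i≤a , c-i≤b
      with left-arm i i≤a (≤-trans i≤c c≤ℓ) | right-arm (c ∸ i) c-i≤b (≤-trans (m∸n≤m c i) c≤ℓ)
    ... | La , brA , sizeA | Lb , brB , sizeB =
      i , i≤c , La ++ Lb ,
      branches-weaken (λ z∈ → proj₂ (side z∈))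
        (branches-++ forest (λ u∈a u∈b → a#mb u∈a (there u∈b) refl) brA brB) ,
      subst (x α s i + x α s (c ∸ i) ≤_) (sym (length-++ La)) (+-mono-≤ sizeA sizeB)

  candidate-branches : ∀ {m s} → Forest N (suc m) → Bounded m → ∀ q → Cand N col m s q →
    ∀ c → c ≤ ℓ s ∸ 1 → suc c ≤ length q →
    ∃ λ j → j ≤ c × ∃ λ L → Branches m (λ u → col u ≡ s) L × x α s j + x α s (c ∸ j) ≤ length L
  candidate-branches forest bounded q ((q! , q<m+1 , lq) , m∈q , colours) c c≤ℓ c<q with ∈-∃++ m∈q
  ... | a , b , refl = Arms.both-arms bounded a b q! q<m+1 lq colours forest c c≤ℓ
    (≤-pred (subst (suc c ≤_) (trans (length-++ a) (+-suc (length a) (length b))) c<q))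

  colour-branches : ∀ {m} → Forest N (suc m) → (g : Fin r → ℕ) →
    (∀ s → ∃ λ L → Branches m (λ u → col u ≡ s) L × g s ≤ length L) →
    ∀ cs → Unique cs → ∃ λ L → Branches m (λ u → col u ∈ cs) L × sum (map g cs) ≤ length L
  colour-branches forest g per-colour [] [] = [] , ([] , []) , z≤n
  colour-branches forest g per-colour (s ∷ cs) (s∉cs ∷ cs!)
    with per-colour s | colour-branches forest g per-colour cs cs!
  ... | L₁ , br₁ , size₁ | L₂ , br₂ , size₂ =
    L₁ ++ L₂ ,
    branches-weaken [ here , there ]′
      (branches-++ forest (λ cu≡s cu∈cs → All.lookup s∉cs cu∈cs (sym cu≡s)) br₁ br₂) ,
    subst (g s + sum (map g cs) ≤_) (sym (length-++ L₁)) (+-mono-≤ size₁ size₂)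

  λ′ : ℕ → Fin r → ℕ
  λ′ m s = proj₁ (longest-candidate col m s)

  longest : ∀ m s → IsLongest N col m s (λ′ m s)
  longest m s = proj₂ (longest-candidate col m s)

  module Induction (n : ℕ) (forest : (m : ℕ) → m ≤ n → Forest N m)
    (strategy : (j : ℕ) → j < n → APMove ℓ α N col j) (not-ended : ¬ Ended ℓ N col n) where

    -- If m gets colour s, a candidate for s is a monochromatic path; as the game
    -- has not ended, it has fewer than ℓ_s vertices.
    candidate-short : ∀ {m s q} → suc m ≤ n → col m ≡ s → Cand N col m s q → length q < ℓ s
    candidate-short {m} {s} {q} m<n col-m ((q! , q<m+1 , lq) , _ , colours) with ℓ s ≤? length q
    ... | no ℓ≰q = ≰⇒> ℓ≰q
    ... | yes ℓ≤q = ⊥-elim (not-ended (s , take (ℓ s) q , path , len , AllP.take⁺ (ℓ s) mono))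
      where
      mono : Mono col s q
      mono = All.map [ (λ { refl → col-m }) , id ]′ colours
      path : IsPath N n (take (ℓ s) q)
      path = path-lift m<n (UP.take⁺ (ℓ s) q! , AllP.take⁺ (ℓ s) q<m+1 , linked-take (ℓ s) lq)
      len : length (take (ℓ s) q) ≡ ℓ s
      len = trans (length-take (ℓ s) q) (m≤n⇒m⊓n≡m ℓ≤q)

    -- AP_α chose the index i with
    -- α = pre ++ σ ∷ post, ν_{i,σ} = λ′_σ ⊓ ℓ_σ and ν_{i,s′} ≤ λ′_{s′} ⊓ ℓ_{s′}.
    -- Then for every colour s′ the longest candidate has more than ν_{i,s′} - 1
    -- vertices, so its arms give branches at colour-s′ neighbours of m of total
    -- size at least min_{j₁+j₂=ν_{i,s′}-1} (x_{s′,j₁} + x_{s′,j₂}); together with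
    -- m these are at least k_i vertices.
    branches-of-step : ∀ m → suc m ≤ n → Bounded m → ∀ pre σ post → α ≡ pre ++ σ ∷ post →
      ν pre σ ≡ λ′ m σ ⊓ ℓ σ → (∀ s′ → s′ ≢ σ → ν pre s′ ≤ λ′ m s′ ⊓ ℓ s′) →
      ∃ λ L → Branches m (λ u → col u ∈ allFin r) L × kVal (table pre) (counts pre) ≤ length (m ∷ L)
    branches-of-step m m<n bounded pre σ post α≡ ν≡ ν≤
      with colour-branches (forest (suc m) m<n) _ per-colour (allFin r) (UP.allFin⁺ r)
      where
      ν-bound : ∀ s′ → ν pre s′ ≤ λ′ m s′ ⊓ ℓ s′
      ν-bound s′ with s′ ≟ᶠ σ
      ... | yes refl = ≤-reflexive ν≡
      ... | no s′≢σ = ν≤ s′ s′≢σ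
      per-colour : ∀ s′ → ∃ λ L → Branches m (λ u → col u ≡ s′) L ×
        minSplit (table pre s′) (counts pre s′) ≤ length L
      per-colour s′ with longest m s′
      ... | (q , cand-q , len-q) , _
        with candidate-branches (forest (suc m) m<n) bounded q cand-q (count s′ pre)
               (∸-monoˡ-≤ 1 (≤-trans (ν-bound s′) (m⊓n≤n _ _)))
               (≤-trans (ν-bound s′) (≤-trans (m⊓n≤m _ _) (≤-reflexive (sym len-q))))
      ... | j , j≤c , L , br , size = L , br , ≤-trans (minSplit-table pre σ post α≡ s′ j≤c) size
    ... | L , br , sum≤L = L , br , s≤s sum≤L

    -- The inductive step when the path contains the new vertex m: the path forces
    -- the colour σ chosen by AP_α to be s, and t ≤ λ′_s ⊓ ℓ_s = ν_{i,s}, so the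
    -- component of m has at least k_i = x_{s,ν_{i,s}} ≥ x_{s,t} vertices.
    bounded-new : ∀ m → suc m ≤ n → Bounded m → ∀ s t → t ≤ ℓ s ∸ 1 → (p : List ℕ) → IsPath N (suc m) p →
      length p ≡ t → Mono col s p → ∀ v → v ∈ p → m ∈ p → ComponentAtLeast N (suc m) v (x α s t)
    bounded-new m m<n bounded s t t≤ℓ p path@(_ , _ , lp) refl mono v v∈ m∈
      with strategy m m<n (λ′ m) (longest m) (s , ≤-<-trans (m⊓n≤m (λ′ m s) (ℓ s)) λ′<ℓ)
      where
      λ′<ℓ : λ′ m s < ℓ s
      λ′<ℓ with longest m s
      ... | (q , cand-q , len-q) , _ = subst (_< ℓ s) len-q (candidate-short m<n (All.lookup mono m∈) cand-q)
    ... | pre , σ , post , α≡ , ν≡ , ν≤ , col≡σ with trans (sym col≡σ) (All.lookup mono m∈)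
    ... | refl with branches-of-step m m<n bounded pre σ post α≡ ν≡ ν≤
    ... | L , br , k≤ = m ∷ L , branches-component br (linked-connected lp v∈ m∈) , size
      where
      t≤ν : length p ≤ ν pre σ
      t≤ν = subst (length p ≤_) (sym ν≡) (⊓-glb (proj₂ (longest m σ) p (path , m∈ , All.map inj₂ mono))
              (≤-trans t≤ℓ (m∸n≤m (ℓ σ) 1)))
      size : x α σ (length p) ≤ length (m ∷ L)
      size = begin
        x α σ (length p)                 ≤⟨ x-mono α σ t≤ν (ν-≤-count pre σ post α≡) ⟩
        x α σ (ν pre σ)                  ≡⟨ x-new pre σ post α≡ ⟩
        kVal (table pre) (counts pre)    ≤⟨ k≤ ⟩
        length (m ∷ L)                   ∎
        where open ≤-Reasoning

    bounded : ∀ m → m ≤ n → Bounded m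
    bounded zero _ s t t≤ℓ p (_ , p<0 , _) len mono v v∈ = ⊥-elim (n≮0 (All.lookup p<0 v∈))
    bounded (suc m) m<n s t t≤ℓ p path len mono v v∈ with m ∈? p
    ... | yes m∈ = bounded-new m m<n (bounded m (<⇒≤ m<n)) s t t≤ℓ p path len mono v v∈ m∈
    ... | no m∉ = component-lift (n≤1+n m)
                    (bounded m (<⇒≤ m<n) s t t≤ℓ p (path-restrict path m∉) len mono v v∈)

lemma14 : (r : ℕ) → 2 ≤ r → (ℓ : Fin r → ℕ) → ((s : Fin r) → 1 ≤ ℓ s) →
  (α : List (Fin r)) → InW ℓ α →
  (k : ℕ) → 1 ≤ k →
  (N : ℕ → List ℕ) → (col : ℕ → Fin r) → (n : ℕ) →
  ((j : ℕ) → j < n → All (_< j) (N j)) →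
  ((m : ℕ) → m ≤ n → Forest N m × ComponentsAtMost N m k) →
  ((j : ℕ) → j < n → APMove ℓ α N col j) →
  ¬ Ended ℓ N col n →
  (s : Fin r) → (t : ℕ) → t ≤ ℓ s ∸ 1 →
  (p : List ℕ) → IsPath N n p → length p ≡ t → Mono col s p →
  (v : ℕ) → v ∈ p → ComponentAtLeast N n v (x α s t)
lemma14 r _ ℓ _ α _ k _ N col n _ boards strategy not-ended =
  Game.Induction.bounded ℓ α N col n (λ m m≤n → proj₁ (boards m m≤n)) strategy not-ended n ≤-refl
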